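{- Let $P$ be a finite poset, $\mathbb{S}$ a skew field containing an infinite field as a subfield, and $C$ a central element of $\mathbb{S}$. Then $\operatorname{NOR}=\Theta\circ\Delta^{ -1}\circ\nabla$ (as partial maps $\mathbb{S}^P\dashrightarrow\mathbb{S}^P$, wherever defined).
   Context: $\mathbb{S}^P$ is the set of labelings $f:P\to\mathbb{S}$; products of maps denote composition, rightmost first. For $x\in\mathbb{S}$, $\overline{x}=x^{ -1}$; the parallel sum of $z_1,\dots,z_m$ is $\sum^{\parallel}_i z_i=\overline{\overline{z_1}+\cdots+\overline{z_m}}$. $\widehat P$ is $P$ with a new minimum $\widehat0$ and maximum $\widehat1$; $x\lessdot y$ means $y$ covers $x$ in $\widehat P$. Noncommutative order toggle: $T_v$ changes only the label at $v$: $(T_vf)(v)=\Big(\sum_{u\lessdot v}f(u)\Big)\overline{f(v)}\Big(\sum^{\parallel}_{u\gtrdot v}f(u)\Big)$ with $f(\widehat0)=1$, $f(\widehat1)=C$. $\operatorname{NOR}=T_{x_1}T_{x_2}\cdots T_{x_n}$ for any linear extension $(x_1,\dots,x_n)$ of $P$ (listing with $x_i<x_j\Rightarrow i<j$). Transfer maps: $(\Theta f)(x)=C\,\overline{f(x)}$; $(\nabla f)(x)=f(x)\,\overline{\sum_{y\lessdot x}f(y)}$ with $f(\widehat0)=1$; $(\Delta^{ -1}f)(x)=\sum f(y_k)\cdots f(y_2)f(y_1)$ over all chains $x=y_1\lessdot y_2\lessdot\cdots\lessdot y_k\lessdot\widehat1$. -}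

module Defs where

open import Level using (Level; _⊔_) renaming (suc to lsuc)
open import Data.Nat using (ℕ; zero; suc) renaming (_<_ to _<ℕ_)
open import Data.Fin using (Fin; toℕ) renaming (_≟_ to _≟F_)
open import Data.Bool using (Bool; true; false; _∧_; not; if_then_else_)
open import Data.List using (List; []; _∷_; _++_; map; foldr; filterᵇ; allFin; concatMap; upTo)
open import Data.Bool.ListAction using (any)
open import Data.List.Relation.Unary.All using (All)
open import Data.Product using (_×_; _,_; proj₁; proj₂)
open import Relation.Nullary using (¬_; Dec; yes; no)
open import Relation.Nullary.Decidable using (⌊_⌋)
open import Relation.Binary.Definitions using (Decidable)
open import Relation.Binary.Structures using (IsPartialOrder)
open import Relation.Binary.PropositionalEquality using (_≡_; _≢_)
open import Algebra.Bundles using (Ring)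

-- The inverse is a total operation whose
-- value at 0 is irrelevant junk; every use of an inverse in the maps
-- below records the inverted element as a definedness side condition.

record SkewField (c ℓ : Level) : Set (lsuc (c ⊔ ℓ)) where
  field
    ring : Ring c ℓ
  open Ring ring public
  field
    _⁻¹      : Carrier → Carrier
    0≉1      : ¬ (0# ≈ 1#)
    ⁻¹-inverseʳ : ∀ x → ¬ (x ≈ 0#) → x * (x ⁻¹) ≈ 1#
    ⁻¹-inverseˡ : ∀ x → ¬ (x ≈ 0#) → (x ⁻¹) * x ≈ 1#

record InfiniteSubfield {c ℓ : Level} (S : SkewField c ℓ) (k : Level) : Set (lsuc k ⊔ c ⊔ ℓ) where
  open SkewField S
  field
    K        : Carrier → Set k
    K-resp   : ∀ {x y} → x ≈ y → K x → K y
    K-0      : K 0#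
    K-1      : K 1#
    K-+      : ∀ {x y} → K x → K y → K (x + y)
    K-neg    : ∀ {x} → K x → K (- x)
    K-*      : ∀ {x y} → K x → K y → K (x * y)
    K-⁻¹     : ∀ {x} → K x → ¬ (x ≈ 0#) → K (x ⁻¹)
    K-comm   : ∀ {x y} → K x → K y → x * y ≈ y * x
    elt      : ℕ → Carrier
    elt-K    : ∀ m → K (elt m)
    elt-inj  : ∀ m m' → elt m ≈ elt m' → m ≡ m'

Central : {c ℓ : Level} (S : SkewField c ℓ) → SkewField.Carrier S → Set (c ⊔ ℓ)
Central S C = ∀ x → C * x ≈ x * C
  where open SkewField S

-- Finite posets: (up to isomorphism) a decidable partial order on Fin n.

record FinPoset (n : ℕ) : Set₁ where
  field
    _≼_            : Fin n → Fin n → Set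
    isPartialOrder : IsPartialOrder _≡_ _≼_
    _≼?_           : Decidable _≼_

  _≺ᵇ_ : Fin n → Fin n → Bool
  a ≺ᵇ b = ⌊ a ≼? b ⌋ ∧ not ⌊ a ≟F b ⌋

  _≺_ : Fin n → Fin n → Set
  a ≺ b = a ≼ b × a ≢ b

-- Elements of P-hat = P with new minimum ⊥̂ and maximum ⊤̂.
data Hat (n : ℕ) : Set where
  ⊥̂ : Hat n
  ι  : Fin n → Hat n
  ⊤̂ : Hat n

module PosetHat {n : ℕ} (P : FinPoset n) where
  open FinPoset P

  allHat : List (Hat n)
  allHat = ⊥̂ ∷ ⊤̂ ∷ map ι (allFin n)

  _<̂_ : Hat n → Hat n → Bool
  ⊥̂   <̂ ⊥̂   = false
  ⊥̂   <̂ _   = true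
  ι a <̂ ι b = a ≺ᵇ b
  ι a <̂ ⊤̂   = true
  ι a <̂ ⊥̂   = false
  ⊤̂   <̂ _   = false

  _⋖_ : Hat n → Hat n → Bool
  x ⋖ y = (x <̂ y) ∧ not (any (λ z → (x <̂ z) ∧ (z <̂ y)) allHat)

  below : Hat n → List (Hat n)
  below y = filterᵇ (λ u → u ⋖ y) allHat

  above : Hat n → List (Hat n)
  above x = filterᵇ (λ u → x ⋖ u) allHat

  listsOf : ℕ → List (List (Fin n))
  listsOf zero    = [] ∷ []
  listsOf (suc k) = concatMap (λ a → map (a ∷_) (listsOf k)) (allFin n)

  -- is (y₁,…,y_k) a chain x = y₁ ⋖ y₂ ⋖ ⋯ ⋖ y_k ⋖ ⊤̂ in P-hat ?
  chainTo⊤ : Fin n → List (Fin n) → Bool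
  chainTo⊤ y []       = y' ⋖ ⊤̂ where y' = ι y
  chainTo⊤ y (z ∷ zs) = (ι y ⋖ ι z) ∧ chainTo⊤ z zs

  isChainFrom : Fin n → List (Fin n) → Bool
  isChainFrom x []       = false
  isChainFrom x (y ∷ ys) = ⌊ y ≟F x ⌋ ∧ chainTo⊤ y ys

  -- all such chains (they have length between 1 and n)
  chainsFrom : Fin n → List (List (Fin n))
  chainsFrom x = concatMap (λ k → filterᵇ (isChainFrom x) (listsOf (suc k))) (upTo n)

-- Partial computations: a value together with the list of elements that
-- got inverted; the computation is defined iff all of them are nonzero.

module Maps {n : ℕ} (P : FinPoset n) {c ℓ : Level} (S : SkewField c ℓ)
            (C : SkewField.Carrier S) where
  open FinPoset P
  open PosetHat P
  open SkewField S

  Labeling : Set c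
  Labeling = Fin n → Carrier

  Partial : Set c → Set c
  Partial A = A × List Carrier

  Defined : {A : Set c} → Partial A → Set (c ⊔ ℓ)
  Defined (_ , zs) = All (λ z → ¬ (z ≈ 0#)) zs

  value : {A : Set c} → Partial A → A
  value = proj₁

  sumL : List Carrier → Carrier
  sumL = foldr _+_ 0#

  ext : Labeling → Hat n → Carrier
  ext f ⊥̂     = 1#
  ext f (ι a) = f a
  ext f ⊤̂     = C

  parSum : List Carrier → Partial Carrier
  parSum zs = ((sumL (map _⁻¹ zs)) ⁻¹ , zs ++ (sumL (map _⁻¹ zs) ∷ []))

  update : Labeling → Fin n → Carrier → Labeling
  update f v a w = if ⌊ w ≟F v ⌋ then a else f w

  toggle : Fin n → Partial Labeling → Partial Labeling
  toggle v (f , zs) =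
    ( update f v (sumL (map (ext f) (below (ι v))) * (f v ⁻¹) * proj₁ par)
    , zs ++ (f v ∷ proj₂ par) )
    where par = parSum (map (ext f) (above (ι v)))

  record LinearExtension : Set where
    field
      x       : Fin n → Fin n
      x-inj   : ∀ i j → x i ≡ x j → i ≡ j
      x-order : ∀ i j → x i ≺ x j → toℕ i <ℕ toℕ j

  -- NOR = T_{x₁} T_{x₂} ⋯ T_{xₙ}  (rightmost applied first)
  NOR : LinearExtension → Labeling → Partial Labeling
  NOR L f = foldr toggle (f , []) (map (LinearExtension.x L) (allFin n))

  Θ : Partial Labeling → Partial Labeling
  Θ (f , zs) = ((λ a → C * (f a ⁻¹)) , zs ++ map f (allFin n))

  ∇ : Labeling → Partial Labeling
  ∇ f = ((λ a → f a * (low a ⁻¹)) , map low (allFin n))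
    where low : Fin n → Carrier
          low a = sumL (map (ext f) (below (ι a)))

  Δ⁻¹ : Labeling → Labeling
  Δ⁻¹ f a = sumL (map revProd (chainsFrom a))
    where revProd : List (Fin n) → Carrier
          revProd = foldr (λ y acc → acc * f y) 1#

  Δ⁻¹ₚ : Partial Labeling → Partial Labeling
  Δ⁻¹ₚ (f , zs) = (Δ⁻¹ f , zs)

  RHS : Labeling → Partial Labeling
  RHS f = Θ (Δ⁻¹ₚ (∇ f))

module Submission where

-- Write h = ∇ f, so h(a) = f(a) · (Σ_{u ⋖ a} f(u))⁻¹, and D = Δ⁻¹ h; the
-- right-hand side is the labeling target(a) = C · D(a)⁻¹.  Two facts:
--
-- (1) Chain recurrence.  Splitting off the first step of each chain
--     a = y₁ ⋖ y₂ ⋖ ⋯ ⋖ ⊤̂ gives  D(a) = (Σ_{u ⋗ a} D̂(u)) · h(a),  where D̂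
--     extends D by D̂(⊤̂) = 1.  To shift the sum over chain lengths by one we
--     need that no chain has n steps above a, which a strictly monotone rank
--     with values below n (the position in a linear extension) guarantees.
-- (2) Toggle invariant.  NOR toggles xₙ first and x₁ last.  Along this
--     schedule, toggled elements carry their target and the others still
--     carry f: when v is toggled, everything below v carries f and everything
--     above v its target, so (1) and the centrality of C turn the toggle
--     formula into target(v).

open import Defs
open import Level using (Level)
open import Algebra.Bundles using (Ring)
open import Data.Nat using (ℕ; zero; suc)
import Data.Nat as ℕ
import Data.Nat.Properties as ℕP
open import Data.Fin using (Fin; toℕ; punchOut) renaming (zero to fzero; suc to fsuc)
open import Data.Fin.Properties using (any?; punchOut-injective; injective⇒≤; toℕ<n) renaming (_≟_ to _≟F_)
open import Data.Bool using (Bool; true; false; _∧_; if_then_else_; T)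
open import Data.Bool.Properties using (T-≡; T?)
open import Data.List using (List; []; _∷_; _++_; map; foldr; filterᵇ; concatMap; upTo; allFin)
open import Data.List.Properties using (applyUpTo-∷ʳ; map-applyUpTo; map-tabulate; map-∘; map-cong)
open import Data.List.Relation.Unary.All as All using (All; []; _∷_)
import Data.List.Relation.Unary.All.Properties as All
open import Data.List.Relation.Unary.Any as Any using (here; there)
open import Data.List.Membership.Propositional using (_∈_; _∉_)
open import Data.List.Membership.Propositional.Properties using (∈-map⁺; ∈-map⁻; ∈-allFin)
open import Data.Product using (_×_; _,_; proj₁; proj₂; ∃)
open import Data.Empty using (⊥-elim)
open import Data.Unit using (⊤; tt)
open import Function using (_∘_; Equivalence)
open import Relation.Nullary using (¬_; yes; no)
open import Relation.Nullary.Decidable using (⌊_⌋)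
open import Relation.Binary.PropositionalEquality as ≡ using (_≡_)

-- An injective map Fin n → Fin n is onto: were w missed, punching w out
-- would give an injection Fin n → Fin (n-1).
injective⇒onto : ∀ {n} (x : Fin n → Fin n) → (∀ i j → x i ≡ x j → i ≡ j) →
                 ∀ w → ∃ λ i → x i ≡ w
injective⇒onto {suc m} x x-inj w with any? (λ i → x i ≟F w)
... | yes hit  = hit
... | no  miss = ⊥-elim (ℕP.1+n≰n (injective⇒≤ {f = g} g-inj))
  where
  g : Fin (suc m) → Fin m
  g i = punchOut {i = w} {j = x i} (λ eq → miss (i , ≡.sym eq))
  g-inj : ∀ {i j} → g i ≡ g j → i ≡ j
  g-inj {i} {j} eq = x-inj i j (punchOut-injective {i = w} _ _ eq)

-- Index lists in which every entry is followed by exactly the larger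
-- indices; allFin is one.  Mapped through a linear extension they give
-- the toggle schedule of NOR.
UpperTails : ∀ {m} → List (Fin m) → Set
UpperTails []       = ⊤
UpperTails (i ∷ is) = (∀ j → toℕ i ℕ.< toℕ j → j ∈ is) × All (λ j → toℕ i ℕ.< toℕ j) is × UpperTails is

upperTails-map-suc : ∀ {m} (is : List (Fin m)) → UpperTails is → UpperTails (map fsuc is)
upperTails-map-suc []       tt                        = tt
upperTails-map-suc (i ∷ is) (later∈ , later , tails) =
  later∈′ , All.map⁺ (All.map ℕ.s≤s later) , upperTails-map-suc is tails
  where
  later∈′ : ∀ j → toℕ (fsuc i) ℕ.< toℕ j → j ∈ map fsuc is
  later∈′ (fsuc j) i<j = ∈-map⁺ fsuc (later∈ j (ℕ.s≤s⁻¹ i<j))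

allFin-upperTails : ∀ m → UpperTails (allFin m)
allFin-upperTails zero    = tt
allFin-upperTails (suc m) rewrite ≡.sym (map-tabulate {n = m} (λ i → i) fsuc) =
  later∈ , All.map⁺ (All.universal (λ _ → ℕ.s≤s ℕ.z≤n) (allFin m)) , upperTails-map-suc (allFin m) (allFin-upperTails m)
  where
  later∈ : ∀ j → 0 ℕ.< toℕ j → j ∈ map fsuc (allFin m)
  later∈ (fsuc j) _ = ∈-map⁺ fsuc (∈-allFin j)

module ListSums {c ℓ} (R : Ring c ℓ) where
  open Ring R renaming (refl to ≈-refl; sym to ≈-sym; trans to ≈-trans)
  open import Algebra.Properties.CommutativeSemigroup +-commutativeSemigroup
    using () renaming (interchange to +-interchange)
  open import Relation.Binary.Reasoning.Setoid setoid

  ∑ : {A : Set} → (A → Carrier) → List A → Carrier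
  ∑ φ l = foldr _+_ 0# (map φ l)

  when : Bool → Carrier → Carrier
  when b x = if b then x else 0#

  ∑-cong : {A : Set} {φ ψ : A → Carrier} (l : List A) → (∀ u → φ u ≈ ψ u) → ∑ φ l ≈ ∑ ψ l
  ∑-cong []      eq = ≈-refl
  ∑-cong (u ∷ l) eq = +-cong (eq u) (∑-cong l eq)

  ∑-congᴬˡˡ : {A : Set} {φ ψ : A → Carrier} {l : List A} → All (λ u → φ u ≈ ψ u) l → ∑ φ l ≈ ∑ ψ l
  ∑-congᴬˡˡ []         = ≈-refl
  ∑-congᴬˡˡ (eq ∷ eqs) = +-cong eq (∑-congᴬˡˡ eqs)

  ∑-zero : {A : Set} {φ : A → Carrier} (l : List A) → (∀ u → φ u ≈ 0#) → ∑ φ l ≈ 0#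
  ∑-zero []      eq = ≈-refl
  ∑-zero (u ∷ l) eq = ≈-trans (+-cong (eq u) (∑-zero l eq)) (+-identityˡ 0#)

  ∑-map : {A B : Set} (φ : B → Carrier) (g : A → B) (l : List A) → ∑ φ (map g l) ≡ ∑ (φ ∘ g) l
  ∑-map φ g l = ≡.cong (foldr _+_ 0#) (≡.sym (map-∘ l))

  ∑-++ : {A : Set} (φ : A → Carrier) (l₁ l₂ : List A) → ∑ φ (l₁ ++ l₂) ≈ ∑ φ l₁ + ∑ φ l₂
  ∑-++ φ []       l₂ = ≈-sym (+-identityˡ _)
  ∑-++ φ (u ∷ l₁) l₂ = ≈-trans (+-cong ≈-refl (∑-++ φ l₁ l₂)) (≈-sym (+-assoc _ _ _))

  ∑-concatMap : {A B : Set} (φ : B → Carrier) (g : A → List B) (l : List A) →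
                ∑ φ (concatMap g l) ≈ ∑ (λ a → ∑ φ (g a)) l
  ∑-concatMap φ g []      = ≈-refl
  ∑-concatMap φ g (a ∷ l) = ≈-trans (∑-++ φ (g a) (concatMap g l)) (+-cong ≈-refl (∑-concatMap φ g l))

  ∑-filter : {A : Set} (φ : A → Carrier) (p : A → Bool) (l : List A) →
             ∑ φ (filterᵇ p l) ≈ ∑ (λ u → when (p u) (φ u)) l
  ∑-filter φ p []      = ≈-refl
  ∑-filter φ p (u ∷ l) with p u
  ... | true  = +-cong ≈-refl (∑-filter φ p l)
  ... | false = ≈-trans (∑-filter φ p l) (≈-sym (+-identityˡ _))

  ∑-*ʳ : {A : Set} (φ : A → Carrier) (y : Carrier) (l : List A) → ∑ φ l * y ≈ ∑ (λ u → φ u * y) l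
  ∑-*ʳ φ y []      = zeroˡ y
  ∑-*ʳ φ y (u ∷ l) = ≈-trans (distribʳ y _ _) (+-cong ≈-refl (∑-*ʳ φ y l))

  ∑-+ : {A : Set} (φ ψ : A → Carrier) (l : List A) → ∑ (λ u → φ u + ψ u) l ≈ ∑ φ l + ∑ ψ l
  ∑-+ φ ψ []      = ≈-sym (+-identityˡ 0#)
  ∑-+ φ ψ (u ∷ l) = ≈-trans (+-cong ≈-refl (∑-+ φ ψ l)) (+-interchange (φ u) (ψ u) (∑ φ l) (∑ ψ l))

  ∑-swap : {A B : Set} (φ : A → B → Carrier) (l₁ : List A) (l₂ : List B) →
           ∑ (λ a → ∑ (φ a) l₂) l₁ ≈ ∑ (λ b → ∑ (λ a → φ a b) l₁) l₂
  ∑-swap φ []       l₂ = ≈-sym (∑-zero l₂ (λ _ → ≈-refl))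
  ∑-swap φ (a ∷ l₁) l₂ = ≈-trans (+-cong ≈-refl (∑-swap φ l₁ l₂))
                                 (≈-sym (∑-+ (φ a) (λ b → ∑ (λ a → φ a b) l₁) l₂))

  ∑-when : {A : Set} (b : Bool) (φ : A → Carrier) (l : List A) →
           ∑ (λ u → when b (φ u)) l ≈ when b (∑ φ l)
  ∑-when true  φ l = ≈-refl
  ∑-when false φ l = ∑-zero l (λ _ → ≈-refl)

  when-∧ : (b d : Bool) (x : Carrier) → when (b ∧ d) x ≡ when b (when d x)
  when-∧ true  d x = ≡.refl
  when-∧ false d x = ≡.refl

  when-*ʳ : (b : Bool) (y z : Carrier) → when b y * z ≈ when b (y * z)
  when-*ʳ true  y z = ≈-refl
  when-*ʳ false y z = zeroˡ z

  when-cong : (b : Bool) {y z : Carrier} → y ≈ z → when b y ≈ when b z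
  when-cong true  eq = eq
  when-cong false eq = ≈-refl

  ∑-allFin-suc : ∀ {m} (φ : Fin (suc m) → Carrier) →
                 ∑ φ (allFin (suc m)) ≡ φ fzero + ∑ (φ ∘ fsuc) (allFin m)
  ∑-allFin-suc φ = ≡.cong (λ l → φ fzero + foldr _+_ 0# l)
                          (≡.trans (map-tabulate fsuc φ) (≡.sym (map-tabulate (λ i → i) (φ ∘ fsuc))))

  ∑-allFin-δ : ∀ {m} (a : Fin m) (G : Fin m → Carrier) →
               ∑ (λ b → when ⌊ b ≟F a ⌋ (G b)) (allFin m) ≈ G a
  ∑-allFin-δ {suc m} fzero G = begin
    ∑ (λ b → when ⌊ b ≟F fzero ⌋ (G b)) (allFin (suc m))
      ≡⟨ ∑-allFin-suc (λ b → when ⌊ b ≟F fzero ⌋ (G b)) ⟩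
    G fzero + ∑ (λ b → when ⌊ fsuc b ≟F fzero ⌋ (G (fsuc b))) (allFin m)
      ≈⟨ +-cong ≈-refl (∑-zero (allFin m) (λ _ → ≈-refl)) ⟩
    G fzero + 0#
      ≈⟨ +-identityʳ _ ⟩
    G fzero ∎
  ∑-allFin-δ {suc m} (fsuc a) G = begin
    ∑ (λ b → when ⌊ b ≟F fsuc a ⌋ (G b)) (allFin (suc m))
      ≡⟨ ∑-allFin-suc (λ b → when ⌊ b ≟F fsuc a ⌋ (G b)) ⟩
    0# + ∑ (λ b → when ⌊ fsuc b ≟F fsuc a ⌋ (G (fsuc b))) (allFin m)
      ≈⟨ +-identityˡ _ ⟩
    ∑ (λ b → when ⌊ fsuc b ≟F fsuc a ⌋ (G (fsuc b))) (allFin m)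
      ≈⟨ ∑-cong (allFin m) shift ⟩
    ∑ (λ b → when ⌊ b ≟F a ⌋ (G (fsuc b))) (allFin m)
      ≈⟨ ∑-allFin-δ a (G ∘ fsuc) ⟩
    G (fsuc a) ∎
    where
    shift : ∀ b → when ⌊ fsuc b ≟F fsuc a ⌋ (G (fsuc b)) ≈ when ⌊ b ≟F a ⌋ (G (fsuc b))
    shift b with b ≟F a
    ... | yes _ = ≈-refl
    ... | no  _ = ≈-refl

  ∑-upTo-head : (φ : ℕ → Carrier) (m : ℕ) → ∑ φ (upTo (suc m)) ≡ φ 0 + ∑ (φ ∘ suc) (upTo m)
  ∑-upTo-head φ m = ≡.cong (λ l → φ 0 + foldr _+_ 0# l)
                           (≡.trans (map-applyUpTo suc φ m) (≡.sym (map-applyUpTo (λ k → k) (φ ∘ suc) m)))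

  ∑-upTo-last : (φ : ℕ → Carrier) (m : ℕ) → ∑ φ (upTo (suc m)) ≈ ∑ φ (upTo m) + φ m
  ∑-upTo-last φ m = begin
    ∑ φ (upTo (suc m))         ≡⟨ ≡.cong (∑ φ) (≡.sym (applyUpTo-∷ʳ (λ k → k) m)) ⟩
    ∑ φ (upTo m ++ (m ∷ []))   ≈⟨ ∑-++ φ (upTo m) (m ∷ []) ⟩
    ∑ φ (upTo m) + (φ m + 0#)  ≈⟨ +-cong ≈-refl (+-identityʳ _) ⟩
    ∑ φ (upTo m) + φ m         ∎

module SkewFieldFacts {c ℓ} (S : SkewField c ℓ) where
  open SkewField S renaming (refl to ≈-refl; sym to ≈-sym; trans to ≈-trans)
  open import Relation.Binary.Reasoning.Setoid setoid

  NonZero : Carrier → Set ℓ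
  NonZero x = ¬ (x ≈ 0#)

  nonZero-resp : ∀ {x y} → NonZero x → x ≈ y → NonZero y
  nonZero-resp x≉0 x≈y y≈0 = x≉0 (≈-trans x≈y y≈0)

  cancelʳ : ∀ {y} a → NonZero y → (a * y) * y ⁻¹ ≈ a
  cancelʳ {y} a y≉0 = begin
    (a * y) * y ⁻¹ ≈⟨ *-assoc _ _ _ ⟩
    a * (y * y ⁻¹) ≈⟨ *-cong ≈-refl (⁻¹-inverseʳ y y≉0) ⟩
    a * 1#         ≈⟨ *-identityʳ a ⟩
    a              ∎

  cancel⁻¹ʳ : ∀ {y} a → NonZero y → (a * y ⁻¹) * y ≈ a
  cancel⁻¹ʳ {y} a y≉0 = begin
    (a * y ⁻¹) * y ≈⟨ *-assoc _ _ _ ⟩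
    a * (y ⁻¹ * y) ≈⟨ *-cong ≈-refl (⁻¹-inverseˡ y y≉0) ⟩
    a * 1#         ≈⟨ *-identityʳ a ⟩
    a              ∎

  cancel⁻¹ˡ : ∀ {y} a → NonZero y → y ⁻¹ * (y * a) ≈ a
  cancel⁻¹ˡ {y} a y≉0 = begin
    y ⁻¹ * (y * a) ≈⟨ *-assoc _ _ _ ⟨
    (y ⁻¹ * y) * a ≈⟨ *-cong (⁻¹-inverseˡ y y≉0) ≈-refl ⟩
    1# * a         ≈⟨ *-identityˡ a ⟩
    a              ∎

  cancel-middle : ∀ {y} a b → NonZero y → (a * y ⁻¹) * (y * b) ≈ a * b
  cancel-middle a b y≉0 = ≈-trans (*-assoc _ _ _) (*-cong ≈-refl (cancel⁻¹ˡ b y≉0))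

  solveʳ : ∀ {x y z} → NonZero y → x * y ≈ z → x ≈ z * y ⁻¹
  solveʳ {x} y≉0 xy≈z = ≈-trans (≈-sym (cancelʳ x y≉0)) (*-cong xy≈z ≈-refl)

  ⁻¹-cong : ∀ {x y} → NonZero x → x ≈ y → x ⁻¹ ≈ y ⁻¹
  ⁻¹-cong {x} {y} x≉0 x≈y = ≈-trans (solveʳ y≉0 (≈-trans (*-cong ≈-refl (≈-sym x≈y)) (⁻¹-inverseˡ x x≉0)))
                                    (*-identityˡ _)
    where y≉0 = nonZero-resp x≉0 x≈y

  ⁻¹-of-quotient : ∀ {w D} C → NonZero w → NonZero D → w ≈ C * D ⁻¹ → w ⁻¹ * C ≈ D
  ⁻¹-of-quotient {w} {D} C w≉0 D≉0 w≈C/D = begin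
    w ⁻¹ * C       ≈⟨ *-cong ≈-refl wD≈C ⟨
    w ⁻¹ * (w * D) ≈⟨ cancel⁻¹ˡ D w≉0 ⟩
    D              ∎
    where
    wD≈C : w * D ≈ C
    wD≈C = ≈-trans (*-cong w≈C/D ≈-refl) (cancel⁻¹ʳ C D≉0)

  -- The algebra of a single toggle: with low = Σ_{u⋖v} f(u), Y = Σ_{u⋗v} f(u)⁻¹
  -- and D = Y·C·f(v)·low⁻¹, the toggled label low·f(v)⁻¹·Y⁻¹ equals C·D⁻¹.
  toggle-identity : ∀ {C} → Central S C → ∀ {low fv Y D} →
                    NonZero low → NonZero fv → NonZero Y → NonZero D →
                    D ≈ (Y * C) * (fv * low ⁻¹) → (low * fv ⁻¹) * Y ⁻¹ ≈ C * D ⁻¹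
  toggle-identity {C} central {low} {fv} {Y} {D} low≉0 fv≉0 Y≉0 D≉0 D≈ = solveʳ D≉0 (begin
    ((low * fv ⁻¹) * Y ⁻¹) * D                         ≈⟨ *-cong ≈-refl (≈-trans D≈ (*-assoc _ _ _)) ⟩
    ((low * fv ⁻¹) * Y ⁻¹) * (Y * (C * (fv * low ⁻¹))) ≈⟨ cancel-middle _ _ Y≉0 ⟩
    (low * fv ⁻¹) * (C * (fv * low ⁻¹))                ≈⟨ *-cong ≈-refl (central _) ⟩
    (low * fv ⁻¹) * ((fv * low ⁻¹) * C)                ≈⟨ *-assoc _ _ _ ⟨
    ((low * fv ⁻¹) * (fv * low ⁻¹)) * C                ≈⟨ *-cong (cancel-middle _ _ fv≉0) ≈-refl ⟩
    (low * low ⁻¹) * C                                 ≈⟨ *-cong (⁻¹-inverseʳ low low≉0) ≈-refl ⟩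
    1# * C                                             ≈⟨ *-identityˡ C ⟩
    C                                                  ∎)

module PosetFacts {n : ℕ} (P : FinPoset n) where
  open FinPoset P
  open PosetHat P

  ⋖⇒≺ : ∀ a b → T (ι a ⋖ ι b) → a ≺ b
  ⋖⇒≺ a b a⋖b with a ≼? b | a ≟F b
  ... | yes a≼b | no a≢b = a≼b , a≢b
  ... | yes _   | yes _  = ⊥-elim a⋖b
  ... | no _    | _      = ⊥-elim a⋖b

  -- A strictly monotone rank with values below n (a linear extension
  -- provides one); it bounds the length of chains.
  record Grading : Set where
    field
      rank      : Fin n → ℕ
      rank<n    : ∀ a → rank a ℕ.< n
      rank-mono : ∀ {a b} → a ≺ b → rank a ℕ.< rank b

  -- A list of elements to be toggled from right to left such that each
  -- element is toggled once, after everything above it and before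
  -- everything below it.
  Schedule : List (Fin n) → Set
  Schedule []       = ⊤
  Schedule (v ∷ vs) = (∀ w → v ≺ w → w ∈ vs) × (∀ w → w ≺ v → w ∉ vs) × v ∉ vs × Schedule vs

module ChainRecurrence {n : ℕ} (P : FinPoset n) {c ℓ} (S : SkewField c ℓ) (C : SkewField.Carrier S)
                       (G : PosetFacts.Grading P) (h : Fin n → SkewField.Carrier S) where
  open PosetHat P
  open PosetFacts P
  open Grading G
  open SkewField S renaming (refl to ≈-refl; sym to ≈-sym; trans to ≈-trans; reflexive to ≈-reflexive)
  open Maps P S C using (Δ⁻¹)
  open ListSums ring
  open import Relation.Binary.Reasoning.Setoid setoid

  weight : List (Fin n) → Carrier
  weight = foldr (λ y acc → acc * h y) 1#

  -- total weight of the chains a ⋖ y₁ ⋖ ⋯ ⋖ y_k ⋖ ⊤̂ (a itself not weighed)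
  W : ℕ → Fin n → Carrier
  W k a = ∑ weight (filterᵇ (chainTo⊤ a) (listsOf k))

  D̂ : Hat n → Carrier
  D̂ ⊥̂     = 0#
  D̂ (ι a) = Δ⁻¹ h a
  D̂ ⊤̂     = 1#

  ∑-listsOf-suc : (p : List (Fin n) → Bool) (k : ℕ) →
                  ∑ weight (filterᵇ p (listsOf (suc k))) ≈
                  ∑ (λ b → ∑ (λ ys → when (p (b ∷ ys)) (weight ys * h b)) (listsOf k)) (allFin n)
  ∑-listsOf-suc p k = begin
    ∑ weight (filterᵇ p (listsOf (suc k)))
      ≈⟨ ∑-filter weight p (listsOf (suc k)) ⟩
    ∑ (λ ys → when (p ys) (weight ys)) (concatMap (λ b → map (b ∷_) (listsOf k)) (allFin n))
      ≈⟨ ∑-concatMap _ _ (allFin n) ⟩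
    ∑ (λ b → ∑ (λ ys → when (p ys) (weight ys)) (map (b ∷_) (listsOf k))) (allFin n)
      ≈⟨ ∑-cong (allFin n) (λ b → ≈-reflexive (∑-map _ (b ∷_) (listsOf k))) ⟩
    ∑ (λ b → ∑ (λ ys → when (p (b ∷ ys)) (weight ys * h b)) (listsOf k)) (allFin n) ∎

  W-through : ∀ k b → ∑ (λ ys → when (chainTo⊤ b ys) (weight ys * h b)) (listsOf k) ≈ W k b * h b
  W-through k b = begin
    ∑ (λ ys → when (chainTo⊤ b ys) (weight ys * h b)) (listsOf k)
      ≈⟨ ∑-cong (listsOf k) (λ ys → ≈-sym (when-*ʳ (chainTo⊤ b ys) (weight ys) (h b))) ⟩
    ∑ (λ ys → when (chainTo⊤ b ys) (weight ys) * h b) (listsOf k)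
      ≈⟨ ∑-*ʳ _ (h b) (listsOf k) ⟨
    ∑ (λ ys → when (chainTo⊤ b ys) (weight ys)) (listsOf k) * h b
      ≈⟨ *-cong (∑-filter weight (chainTo⊤ b) (listsOf k)) ≈-refl ⟨
    W k b * h b ∎

  ∑-when-first : (p : Fin n → Bool) (k : ℕ) →
                 ∑ (λ b → ∑ (λ ys → when (p b ∧ chainTo⊤ b ys) (weight ys * h b)) (listsOf k)) (allFin n) ≈
                 ∑ (λ b → when (p b) (W k b * h b)) (allFin n)
  ∑-when-first p k = ∑-cong (allFin n) λ b → begin
    ∑ (λ ys → when (p b ∧ chainTo⊤ b ys) (weight ys * h b)) (listsOf k)
      ≡⟨ ≡.cong (foldr _+_ 0#) (map-cong (λ ys → when-∧ (p b) (chainTo⊤ b ys) _) (listsOf k)) ⟩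
    ∑ (λ ys → when (p b) (when (chainTo⊤ b ys) (weight ys * h b))) (listsOf k)
      ≈⟨ ∑-when (p b) _ (listsOf k) ⟩
    when (p b) (∑ (λ ys → when (chainTo⊤ b ys) (weight ys * h b)) (listsOf k))
      ≈⟨ when-cong (p b) (W-through k b) ⟩
    when (p b) (W k b * h b) ∎

  chains-of-length : ∀ k a → ∑ weight (filterᵇ (isChainFrom a) (listsOf (suc k))) ≈ W k a * h a
  chains-of-length k a = begin
    ∑ weight (filterᵇ (isChainFrom a) (listsOf (suc k)))
      ≈⟨ ∑-listsOf-suc (isChainFrom a) k ⟩
    ∑ (λ b → ∑ (λ ys → when (⌊ b ≟F a ⌋ ∧ chainTo⊤ b ys) (weight ys * h b)) (listsOf k)) (allFin n)
      ≈⟨ ∑-when-first (λ b → ⌊ b ≟F a ⌋) k ⟩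
    ∑ (λ b → when ⌊ b ≟F a ⌋ (W k b * h b)) (allFin n)
      ≈⟨ ∑-allFin-δ a (λ b → W k b * h b) ⟩
    W k a * h a ∎

  -- the only chain without steps is a ⋖ ⊤̂; longer ones continue through some b ⋗ a
  W-zero : ∀ a → W 0 a ≈ when (ι a ⋖ ⊤̂) 1#
  W-zero a = ≈-trans (∑-filter weight (chainTo⊤ a) ([] ∷ [])) (+-identityʳ _)

  W-suc : ∀ k a → W (suc k) a ≈ ∑ (λ b → when (ι a ⋖ ι b) (W k b * h b)) (allFin n)
  W-suc k a = ≈-trans (∑-listsOf-suc (chainTo⊤ a) k) (∑-when-first (λ b → ι a ⋖ ι b) k)

  -- chains starting at a have fewer than n - rank a steps
  W-vanish : ∀ k a → n ℕ.≤ rank a ℕ.+ k → W k a ≈ 0#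
  W-vanish zero    a n≤ = ⊥-elim (ℕP.<⇒≱ (rank<n a) (ℕP.≤-trans n≤ (ℕP.≤-reflexive (ℕP.+-identityʳ (rank a)))))
  W-vanish (suc k) a n≤ = ≈-trans (W-suc k a) (∑-zero (allFin n) term)
    where
    term : ∀ b → when (ι a ⋖ ι b) (W k b * h b) ≈ 0#
    term b with ι a ⋖ ι b in a⋖b
    ... | false = ≈-refl
    ... | true  = ≈-trans (*-cong (W-vanish k b n≤′) ≈-refl) (zeroˡ _)
      where
      n≤′ : n ℕ.≤ rank b ℕ.+ k
      n≤′ = ℕP.≤-trans n≤ (ℕP.≤-trans (ℕP.≤-reflexive (ℕP.+-suc (rank a) k))
                                      (ℕP.+-monoˡ-≤ k (rank-mono (⋖⇒≺ a b (Equivalence.from T-≡ a⋖b)))))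

  Δ⁻¹-by-length : ∀ a → Δ⁻¹ h a ≈ ∑ (λ k → W k a * h a) (upTo n)
  Δ⁻¹-by-length a = ≈-trans (∑-concatMap weight (λ k → filterᵇ (isChainFrom a) (listsOf (suc k))) (upTo n))
                            (∑-cong (upTo n) (λ k → chains-of-length k a))

  -- summing over all lengths: a chain from a either stops at ⊤̂ or
  -- continues through some b ⋗ a
  W-total : ∀ a → ∑ (λ k → W k a) (upTo n) ≈ ∑ D̂ (above (ι a))
  W-total a = begin
    ∑ (λ k → W k a) (upTo n)
      ≈⟨ +-identityʳ _ ⟨
    ∑ (λ k → W k a) (upTo n) + 0#
      ≈⟨ +-cong ≈-refl (W-vanish n a (ℕP.m≤n+m n (rank a))) ⟨
    ∑ (λ k → W k a) (upTo n) + W n a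
      ≈⟨ ∑-upTo-last (λ k → W k a) n ⟨
    ∑ (λ k → W k a) (upTo (suc n))
      ≡⟨ ∑-upTo-head (λ k → W k a) n ⟩
    W 0 a + ∑ (λ k → W (suc k) a) (upTo n)
      ≈⟨ +-cong (W-zero a) (∑-cong (upTo n) (λ k → W-suc k a)) ⟩
    when (ι a ⋖ ⊤̂) 1# + ∑ (λ k → ∑ (λ b → when (ι a ⋖ ι b) (W k b * h b)) (allFin n)) (upTo n)
      ≈⟨ +-cong ≈-refl (∑-swap _ (upTo n) (allFin n)) ⟩
    when (ι a ⋖ ⊤̂) 1# + ∑ (λ b → ∑ (λ k → when (ι a ⋖ ι b) (W k b * h b)) (upTo n)) (allFin n)
      ≈⟨ +-cong ≈-refl (∑-cong (allFin n) through) ⟩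
    when (ι a ⋖ ⊤̂) 1# + ∑ (λ b → when (ι a ⋖ ι b) (D̂ (ι b))) (allFin n)
      ≡⟨ ≡.cong (when (ι a ⋖ ⊤̂) 1# +_) (∑-map (λ u → when (ι a ⋖ u) (D̂ u)) ι (allFin n)) ⟨
    when (ι a ⋖ ⊤̂) 1# + ∑ (λ u → when (ι a ⋖ u) (D̂ u)) (map ι (allFin n))
      ≈⟨ +-identityˡ _ ⟨
    ∑ (λ u → when (ι a ⋖ u) (D̂ u)) allHat
      ≈⟨ ∑-filter D̂ (λ u → ι a ⋖ u) allHat ⟨
    ∑ D̂ (above (ι a)) ∎
    where
    through : ∀ b → ∑ (λ k → when (ι a ⋖ ι b) (W k b * h b)) (upTo n) ≈ when (ι a ⋖ ι b) (Δ⁻¹ h b)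
    through b = ≈-trans (∑-when (ι a ⋖ ι b) _ (upTo n)) (when-cong (ι a ⋖ ι b) (≈-sym (Δ⁻¹-by-length b)))

  Δ⁻¹-recurrence : ∀ a → Δ⁻¹ h a ≈ ∑ D̂ (above (ι a)) * h a
  Δ⁻¹-recurrence a = begin
    Δ⁻¹ h a                            ≈⟨ Δ⁻¹-by-length a ⟩
    ∑ (λ k → W k a * h a) (upTo n)     ≈⟨ ∑-*ʳ (λ k → W k a) (h a) (upTo n) ⟨
    ∑ (λ k → W k a) (upTo n) * h a     ≈⟨ *-cong (W-total a) ≈-refl ⟩
    ∑ D̂ (above (ι a)) * h a            ∎

module ToggleInvariant {n : ℕ} (P : FinPoset n) {c ℓ} (S : SkewField c ℓ) (C : SkewField.Carrier S)
                       (central : Central S C) (G : PosetFacts.Grading P) (f : Fin n → SkewField.Carrier S) where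
  open FinPoset P
  open PosetHat P
  open PosetFacts P
  open SkewField S renaming (refl to ≈-refl; sym to ≈-sym; trans to ≈-trans)
  open SkewFieldFacts S
  open Maps P S C
  open ListSums ring
  open import Relation.Binary.Reasoning.Setoid setoid

  low : Fin n → Carrier
  low a = sumL (map (ext f) (below (ι a)))

  h : Labeling
  h = value (∇ f)

  open ChainRecurrence P S C G h using (D̂; Δ⁻¹-recurrence)

  target : Labeling
  target = value (RHS f)

  toggled : Labeling → Fin n → Carrier
  toggled g v = sumL (map (ext g) (below (ι v))) * (g v ⁻¹) * value (parSum (map (ext g) (above (ι v))))

  run : List (Fin n) → Partial Labeling
  run vs = foldr toggle (f , []) vs

  Invariant : List (Fin n) → Labeling → Set ℓ
  Invariant vs g = (∀ w → w ∈ vs → g w ≈ target w) × (∀ w → w ∉ vs → g w ≈ f w)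

  module _ (defined : Defined (RHS f)) where

    low≉0 : ∀ a → NonZero (low a)
    low≉0 a = All.lookup (All.map⁻ (All.++⁻ˡ (map low (allFin n)) defined)) (∈-allFin a)

    Δ⁻¹h≉0 : ∀ a → NonZero (Δ⁻¹ h a)
    Δ⁻¹h≉0 a = All.lookup (All.map⁻ (All.++⁻ʳ (map low (allFin n)) defined)) (∈-allFin a)

    upper-sum : ∀ {g} v → (∀ w → v ≺ w → g w ≈ target w) → All NonZero (map (ext g) (above (ι v))) →
                sumL (map _⁻¹ (map (ext g) (above (ι v)))) * C ≈ ∑ D̂ (above (ι v))
    upper-sum {g} v above-target above≉0 = begin
      sumL (map _⁻¹ (map (ext g) (above (ι v)))) * C
        ≡⟨ ≡.cong (λ l → sumL l * C) (≡.sym (map-∘ (above (ι v)))) ⟩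
      ∑ (λ u → ext g u ⁻¹) (above (ι v)) * C
        ≈⟨ ∑-*ʳ _ C (above (ι v)) ⟩
      ∑ (λ u → ext g u ⁻¹ * C) (above (ι v))
        ≈⟨ ∑-congᴬˡˡ (All.zipWith (λ (v⋖u , gu≉0) → term _ v⋖u gu≉0)
                                  (All.all-filter (T? ∘ (ι v ⋖_)) allHat , All.map⁻ above≉0)) ⟩
      ∑ D̂ (above (ι v)) ∎
      where
      term : ∀ u → T (ι v ⋖ u) → NonZero (ext g u) → ext g u ⁻¹ * C ≈ D̂ u
      term ⊤̂     _   C≉0 = ⁻¹-inverseˡ C C≉0
      term (ι z) v⋖z gz≉0 = ⁻¹-of-quotient C gz≉0 (Δ⁻¹h≉0 z) (above-target z (⋖⇒≺ v z v⋖z))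

    toggle-hits-target : ∀ {g} v → g v ≈ f v → (∀ w → w ≺ v → g w ≈ f w) →
                         (∀ w → v ≺ w → g w ≈ target w) →
                         All NonZero (g v ∷ proj₂ (parSum (map (ext g) (above (ι v))))) →
                         toggled g v ≈ target v
    toggle-hits-target {g} v gv≈fv below-f above-target (gv≉0 ∷ par≉0) = begin
      toggled g v              ≈⟨ *-cong (*-cong low-unchanged (⁻¹-cong gv≉0 gv≈fv)) ≈-refl ⟩
      (low v * f v ⁻¹) * Y ⁻¹  ≈⟨ toggle-identity central (low≉0 v) (nonZero-resp gv≉0 gv≈fv) Y≉0 (Δ⁻¹h≉0 v) Δ⁻¹h≈ ⟩
      target v                 ∎
      where
      Y : Carrier
      Y = sumL (map _⁻¹ (map (ext g) (above (ι v))))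
      Y≉0 : NonZero Y
      Y≉0 = All.head (All.++⁻ʳ (map (ext g) (above (ι v))) par≉0)

      unchanged : ∀ {u} → T (u ⋖ ι v) → ext g u ≈ ext f u
      unchanged {⊥̂}   _   = ≈-refl
      unchanged {ι w} w⋖v = below-f w (⋖⇒≺ w v w⋖v)
      low-unchanged : sumL (map (ext g) (below (ι v))) ≈ low v
      low-unchanged = ∑-congᴬˡˡ (All.map (λ {u} → unchanged {u}) (All.all-filter (T? ∘ (_⋖ ι v)) allHat))

      Δ⁻¹h≈ : Δ⁻¹ h v ≈ (Y * C) * (f v * low v ⁻¹)
      Δ⁻¹h≈ = ≈-trans (Δ⁻¹-recurrence v)
                      (*-cong (≈-sym (upper-sum v above-target (All.++⁻ˡ (map (ext g) (above (ι v))) par≉0))) ≈-refl)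

    invariant : ∀ vs → Schedule vs → Defined (run vs) → Invariant vs (value (run vs))
    invariant []       _                              _       = (λ _ ()) , (λ _ _ → ≈-refl)
    invariant (v ∷ vs) (up , down , fresh , schedule) defined = toggled-ok , untoggled-ok
      where
      g : Labeling
      g = value (run vs)
      IH : Invariant vs g
      IH = invariant vs schedule (All.++⁻ˡ (proj₂ (run vs)) defined)

      v-ok : toggled g v ≈ target v
      v-ok = toggle-hits-target v (proj₂ IH v fresh) (λ w w≺v → proj₂ IH w (down w w≺v))
                                  (λ w v≺w → proj₁ IH w (up w v≺w)) (All.++⁻ʳ (proj₂ (run vs)) defined)

      toggled-ok : ∀ w → w ∈ v ∷ vs → value (run (v ∷ vs)) w ≈ target w
      toggled-ok w w∈ with w ≟F v
      ... | yes ≡.refl = v-ok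
      ... | no  w≢v    = proj₁ IH w (Any.tail w≢v w∈)

      untoggled-ok : ∀ w → w ∉ v ∷ vs → value (run (v ∷ vs)) w ≈ f w
      untoggled-ok w w∉ with w ≟F v
      ... | yes ≡.refl = ⊥-elim (w∉ (here ≡.refl))
      ... | no  _      = proj₂ IH w (w∉ ∘ there)

module LinearExtensionFacts {n : ℕ} (P : FinPoset n) {c ℓ} (S : SkewField c ℓ) (C : SkewField.Carrier S)
                            (L : Maps.LinearExtension P S C) where
  open FinPoset P
  open PosetFacts P
  open Maps.LinearExtension L

  order : List (Fin n)
  order = map x (allFin n)

  x-onto : ∀ w → ∃ λ i → x i ≡ w
  x-onto = injective⇒onto x x-inj

  every-element-scheduled : ∀ w → w ∈ order
  every-element-scheduled w with x-onto w
  ... | i , ≡.refl = ∈-map⁺ x (∈-allFin i)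

  grading : Grading
  grading = record
    { rank      = λ w → toℕ (proj₁ (x-onto w))
    ; rank<n    = λ w → toℕ<n (proj₁ (x-onto w))
    ; rank-mono = monotone
    }
    where
    monotone : ∀ {a b} → a ≺ b → toℕ (proj₁ (x-onto a)) ℕ.< toℕ (proj₁ (x-onto b))
    monotone {a} {b} a≺b with x-onto a | x-onto b
    ... | i , ≡.refl | j , ≡.refl = x-order i j a≺b

  schedule : Schedule order
  schedule = schedule-of (allFin n) (allFin-upperTails n)
    where
    schedule-of : ∀ is → UpperTails is → Schedule (map x is)
    schedule-of []       tt                        = tt
    schedule-of (i ∷ is) (later∈ , later , tails) = above-later , below-not-later , fresh , schedule-of is tails
      where
      above-later : ∀ w → x i ≺ w → w ∈ map x is
      above-later w xi≺w with x-onto w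
      ... | j , ≡.refl = ∈-map⁺ x (later∈ j (x-order i j xi≺w))
      below-not-later : ∀ w → w ≺ x i → w ∉ map x is
      below-not-later w w≺xi w∈ with ∈-map⁻ x w∈
      ... | j , j∈ , ≡.refl = ℕP.<-asym (x-order j i w≺xi) (All.lookup later j∈)
      fresh : x i ∉ map x is
      fresh xi∈ with ∈-map⁻ x xi∈
      ... | j , j∈ , xi≡xj with x-inj i j xi≡xj
      ... | ≡.refl = ℕP.<-irrefl ≡.refl (All.lookup later j∈)

theorem5p12 : {c ℓ k : Level} (n : ℕ) (P : FinPoset n) (S : SkewField c ℓ)
    → InfiniteSubfield S k
    → (C : SkewField.Carrier S) → Central S C
    → (L : Maps.LinearExtension P S C) (f : Maps.Labeling P S C)
    → Maps.Defined P S C (Maps.NOR P S C L f)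
    → Maps.Defined P S C (Maps.RHS P S C f)
    → (a : Fin n)
    → SkewField._≈_ S (Maps.value P S C (Maps.NOR P S C L f) a) (Maps.value P S C (Maps.RHS P S C f) a)
theorem5p12 n P S _ C central L f nor-defined rhs-defined a =
  proj₁ (invariant rhs-defined order schedule nor-defined) a (every-element-scheduled a)
  where
  open LinearExtensionFacts P S C L
  open ToggleInvariant P S C central grading f
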